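{- Let $(Y,\le_Y)$ be a nonempty partially ordered set. The following are equivalent. (i) $(Y,\le_Y)$ is a quasilattice. (ii) For every finite poset $(X,\le_X)$ and every $A\subseteq X$, every isotone map $f\colon A\to Y$ extends to an isotone map $X\to Y$. (iii) For every poset $(X,\le_X)$ and every finite $A\subseteq X$, every isotone map $f\colon A\to Y$ extends to an isotone map $X\to Y$. (iv) For every finite subset $A$ of the poset $(FC,\subseteq)$, every isotone map $f\colon A\to Y$ extends to an isotone map $FC\to Y$.
   Context: A map is isotone if $x\le y$ implies $f(x)\le f(y)$; subsets carry the induced order; an extension of $f\colon A\to Y$ to $X\supseteq A$ is a map agreeing with $f$ on $A$. A poset $(Y,\le_Y)$ is a quasilattice if for all finite $A,B\subseteq Y$ such that $a\le_Y b$ for all $a\in A$, $b\in B$, there exists $y^*\in Y$ with $a\le_Y y^*\le_Y b$ for all $a\in A$, $b\in B$. $FC$ denotes the set of all finite subsets of a countably infinite set, ordered by inclusion. -}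

module Defs where

open import Level using (Level; _⊔_; 0ℓ)
open import Data.Nat using (ℕ)
open import Data.Fin using (Fin)
open import Data.List using (List)
open import Data.Product using (Σ; ∃; ∃-syntax; _×_; _,_; proj₁; proj₂)
open import Relation.Unary using (Pred)
open import Relation.Binary.Bundles using (Poset)
open import Relation.Binary.Structures using (IsPartialOrder; IsPreorder; IsEquivalence)
import Data.List.Membership.Propositional as PropMem
import Data.List.Membership.Setoid as SetoidMem
open import Data.List.Relation.Binary.Subset.Propositional using (_⊆_)
open import Data.List.Relation.Binary.Subset.Propositional.Properties
  using (⊆-refl; ⊆-trans)

module _ {c ℓ₁ ℓ₂ : Level} (Y : Poset c ℓ₁ ℓ₂) where
  open Poset Y
  open PropMem using (_∈_)

  IsQuasilattice : Set (c ⊔ ℓ₂)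
  IsQuasilattice =
    (A B : List Carrier) →
    (∀ {a b} → a ∈ A → b ∈ B → a ≤ b) →
    ∃[ y ] ((∀ {a} → a ∈ A → a ≤ y) × (∀ {b} → b ∈ B → y ≤ b))

module _ {a b₁ b₂ c ℓ₁ ℓ₂ : Level} (X : Poset a b₁ b₂) (Y : Poset c ℓ₁ ℓ₂) where
  private
    module X = Poset X
    module Y = Poset Y

  Isotone : (X.Carrier → Y.Carrier) → Set (a ⊔ b₂ ⊔ ℓ₂)
  Isotone g = ∀ {x y} → x X.≤ y → g x Y.≤ g y

  IsotoneOn : ∀ {p} (P : Pred X.Carrier p) → (Σ X.Carrier P → Y.Carrier) → Set (a ⊔ p ⊔ b₂ ⊔ ℓ₂)
  IsotoneOn P f = ∀ {x y} (px : P x) (py : P y) → x X.≤ y → f (x , px) Y.≤ f (y , py)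

  Extends : ∀ {p} (P : Pred X.Carrier p) → (X.Carrier → Y.Carrier) → (Σ X.Carrier P → Y.Carrier) → Set (a ⊔ p ⊔ ℓ₁)
  Extends P g f = ∀ x (px : P x) → g x Y.≈ f (x , px)

  ExtensionProperty : ∀ {p} (P : Pred X.Carrier p) → Set (a ⊔ b₂ ⊔ c ⊔ ℓ₁ ⊔ ℓ₂ ⊔ p)
  ExtensionProperty P =
    (f : Σ X.Carrier P → Y.Carrier) → IsotoneOn P f →
    ∃[ g ] (Isotone g × Extends P g f)

module _ {a b₁ b₂ : Level} (X : Poset a b₁ b₂) where
  open Poset X

  FinitePoset : Set (a ⊔ b₁)
  FinitePoset = ∃[ n ] Σ (Fin n → Carrier) (λ e → ∀ x → ∃[ i ] e i ≈ x)

  ListSubset : List Carrier → Pred Carrier (a ⊔ b₁)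
  ListSubset as x = SetoidMem._∈_ (Poset.Eq.setoid X) x as

-- FC: finite subsets of the countably infinite set ℕ, ordered by
-- inclusion.  A finite subset is represented by a list of its elements;
-- two lists are equal as subsets iff they have the same members.

_≋_ : List ℕ → List ℕ → Set
xs ≋ ys = (xs ⊆ ys) × (ys ⊆ xs)

FC : Poset 0ℓ 0ℓ 0ℓ
FC = record
  { Carrier = List ℕ
  ; _≈_ = _≋_
  ; _≤_ = _⊆_
  ; isPartialOrder = record
    { isPreorder = record
      { isEquivalence = record
        { refl = (λ z → z) , (λ z → z)
        ; sym = λ { (p , q) → q , p }
        ; trans = λ { (p , q) (r , s) → (λ z → r (p z)) , (λ z → q (s z)) }
        }
      ; reflexive = proj₁
      ; trans = λ p q z → q (p z)
      }
    ; antisym = λ p q → p , q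
    }
  }

-- (i) ⇒ (ii), (iii): only the finitely many points a₁, …, aₙ of A matter,
-- so send x ∈ X to its down-set {k | aₖ ≤ x} in the Boolean lattice of
-- subsets of {1, …, n}.  It suffices to find an isotone G on that lattice
-- with f aₖ ≤ G D for k ∈ D and G D ≤ f aₖ whenever aₖ lies above all of D.
-- G is built by induction on n: first solve on the subsets omitting n,
-- with the upper bounds of both halves, then on the subsets containing n,
-- with the values just found as extra lower bounds; each base case is one
-- application of the quasilattice property.  Forming down-sets of an
-- arbitrary poset is where excluded middle is used.
--
-- (ii), (iii), (iv) ⇒ (i): given finite A ≤ B in Y, realise them as the
-- tips of a "bowtie" aᵢ ≤ c ≤ bⱼ whose only comparabilities between tips
-- are aᵢ ≤ bⱼ.  Then aᵢ ↦ Aᵢ, bⱼ ↦ Bⱼ is isotone, and any isotone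
-- extension sends c to an interpolant.  A bowtie is itself a finite poset
-- whose tips form a finite subset, and it sits in FC as
-- {i} ⊆ [0, n) ⊆ [0, n) ∪ {n + j}.

module Submission where

open import Defs
open import Level using (Level; _⊔_; Lift; lift; lower)
open import Data.Bool using (true)
open import Data.Empty using (⊥; ⊥-elim)
open import Data.Unit using (⊤; tt)
open import Data.Nat using (ℕ; zero; suc; _+_)
open import Data.Nat.Properties using (m+n≮m; +-cancelˡ-≡)
open import Data.Fin using (Fin; zero; suc; toℕ; splitAt; join)
open import Data.Fin.Properties using (toℕ-injective; toℕ<n; splitAt-join)
open import Data.Fin.Subset using (Subset; inside; outside; _⊆_) renaming (_∈_ to _∈ₛ_)
open import Data.Fin.Subset.Properties using (_∈?_; ⊆-refl; drop-∷-⊆; s⊆s; out⊆)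
open import Data.Vec.Base as Vec using (_∷_; [])
open import Data.Vec.Properties using (lookup∘tabulate; []=⇒lookup; lookup⇒[]=)
open import Data.List using (List; _∷_; []; _++_; map; filter; tabulate; allFin; upTo; length; lookup; mapMaybe)
open import Data.List.Relation.Unary.Any using (Any; here; there; index; satisfied)
import Data.List.Relation.Unary.Any as Any
import Data.List.Membership.Setoid.Properties as SetoidMembership
open import Data.List.Relation.Unary.Any.Properties using (lookup-index; map⁺; map⁻; mapMaybe⁺)
open import Data.List.Membership.Propositional using (_∈_; lose)
open import Data.List.Membership.Propositional.Properties
  using (∈-++⁺ˡ; ∈-++⁺ʳ; ∈-++⁻; ∈-map⁺; ∈-map⁻; ∈-filter⁺; ∈-filter⁻; ∈-allFin; ∈-lookup; ∈-tabulate⁺; ∈-upTo⁺; ∈-upTo⁻)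
open import Data.Maybe using (Maybe)
import Data.Maybe as Maybe
import Data.Maybe.Relation.Unary.Any as MaybeAny
open import Data.Product using (Σ; ∃-syntax; _×_; _,_; proj₁; proj₂)
open import Data.Sum using (_⊎_; inj₁; inj₂; [_,_]′)
open import Function using (_∘_; _⇔_; mk⇔)
open import Relation.Unary using (Pred)
open import Relation.Binary.Bundles using (Poset)
open import Relation.Binary.PropositionalEquality as ≡ using (_≡_; refl)
open import Relation.Nullary using (Dec; yes; no; does; ¬_)
open import Relation.Nullary.Decidable using (dec-true; dec⇒maybe)
open import Axiom.ExcludedMiddle using (ExcludedMiddle)

module Bounds {c ℓ₁ ℓ₂} (Y : Poset c ℓ₁ ℓ₂) where
  open Poset Y

  _≤*_ : List Carrier → Carrier → Set (c ⊔ ℓ₂)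
  as ≤* y = ∀ {a} → a ∈ as → a ≤ y

  _*≤_ : Carrier → List Carrier → Set (c ⊔ ℓ₂)
  y *≤ bs = ∀ {b} → b ∈ bs → y ≤ b

inside∷⊈outside∷ : ∀ {n} {p q : Subset n} → ¬ (inside ∷ p ⊆ outside ∷ q)
inside∷⊈outside∷ p⊆q with p⊆q Vec.here
... | ()

dec-witness : ∀ {ℓ} {A : Set ℓ} (a? : Dec A) → does a? ≡ true → A
dec-witness (yes a) _ = a

module _ (em : ∀ {ℓ} → ExcludedMiddle ℓ) {ℓ n} (Q : Fin n → Set ℓ) where

  subsetOf : Subset n
  subsetOf = Vec.tabulate (λ k → does (em {P = Q k}))

  ∈-subsetOf⁺ : ∀ {k} → Q k → k ∈ₛ subsetOf
  ∈-subsetOf⁺ {k} q = lookup⇒[]= k subsetOf (≡.trans (lookup∘tabulate _ k) (dec-true em q))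

  ∈-subsetOf⁻ : ∀ {k} → k ∈ₛ subsetOf → Q k
  ∈-subsetOf⁻ {k} k∈ = dec-witness em (≡.trans (≡.sym (lookup∘tabulate _ k)) ([]=⇒lookup k∈))

module _ {a} {A : Set a} {n} (v : Fin n → A) where

  valuesOn : Subset n → List A
  valuesOn D = map v (filter (_∈? D) (allFin n))

  ∈-valuesOn⁺ : ∀ {D k} → k ∈ₛ D → v k ∈ valuesOn D
  ∈-valuesOn⁺ {D} k∈D = ∈-map⁺ v (∈-filter⁺ (_∈? D) {xs = allFin n} (∈-allFin _) k∈D)

  ∈-valuesOn⁻ : ∀ {D y} → y ∈ valuesOn D → ∃[ k ] (k ∈ₛ D × y ≡ v k)
  ∈-valuesOn⁻ {D} y∈ with ∈-map⁻ v y∈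
  ... | k , k∈ , y≡vk = k , proj₂ (∈-filter⁻ (_∈? D) {xs = allFin n} k∈) , y≡vk

-- Isotone interpolation on the Boolean lattice

module _ {c ℓ₁ ℓ₂} (Y : Poset c ℓ₁ ℓ₂) where
  open Poset Y renaming (refl to ≤-refl; trans to ≤-trans)
  open Bounds Y

  Compatible : ∀ {n} → (Lo Up : Subset n → List Carrier) → Set (c ⊔ ℓ₂)
  Compatible Lo Up = ∀ {D D'} → D ⊆ D' → ∀ {a b} → a ∈ Lo D → b ∈ Up D' → a ≤ b

  record Interpolant {n} (Lo Up : Subset n → List Carrier) : Set (c ⊔ ℓ₂) where
    field
      value   : Subset n → Carrier
      isotone : ∀ {D D'} → D ⊆ D' → value D ≤ value D'
      above   : ∀ D → Lo D ≤* value D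
      below   : ∀ D → value D *≤ Up D

  interpolant : IsQuasilattice Y → ∀ {n} {Lo Up : Subset n → List Carrier} →
                Compatible Lo Up → Interpolant Lo Up
  interpolant q {zero} {Lo} {Up} compat with q (Lo []) (Up []) (compat ⊆-refl)
  ... | y , Lo≤y , y≤Up = record
    { value = λ _ → y ; isotone = λ _ → ≤-refl
    ; above = λ { [] → Lo≤y } ; below = λ { [] → y≤Up } }
  interpolant q {suc n} {Lo} {Up} compat = record
    { value = G ; isotone = G-isotone ; above = G-above ; below = G-below }
    where
    Lo₀ Up₀ : Subset n → List Carrier
    Lo₀ D = Lo (outside ∷ D)
    Up₀ D = Up (outside ∷ D) ++ Up (inside ∷ D)

    compat₀ : Compatible Lo₀ Up₀
    compat₀ {D} {D'} D⊆D' a∈ b∈ with ∈-++⁻ (Up (outside ∷ D')) b∈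
    ... | inj₁ b∈₀ = compat (s⊆s D⊆D') a∈ b∈₀
    ... | inj₂ b∈₁ = compat (out⊆ D⊆D') a∈ b∈₁

    module I₀ = Interpolant (interpolant q compat₀)

    Lo₁ Up₁ : Subset n → List Carrier
    Lo₁ D = I₀.value D ∷ Lo (inside ∷ D)
    Up₁ D = Up (inside ∷ D)

    compat₁ : Compatible Lo₁ Up₁
    compat₁ {D} {D'} D⊆D' (here refl) b∈ = ≤-trans (I₀.isotone D⊆D') (I₀.below D' (∈-++⁺ʳ _ b∈))
    compat₁ D⊆D' (there a∈) b∈ = compat (s⊆s D⊆D') a∈ b∈

    module I₁ = Interpolant (interpolant q compat₁)

    G : Subset (suc n) → Carrier
    G (outside ∷ D) = I₀.value D
    G (inside ∷ D) = I₁.value D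

    G-isotone : ∀ {D D'} → D ⊆ D' → G D ≤ G D'
    G-isotone {outside ∷ D} {outside ∷ D'} p = I₀.isotone (drop-∷-⊆ p)
    G-isotone {outside ∷ D} {inside ∷ D'} p = ≤-trans (I₁.above D (here refl)) (I₁.isotone (drop-∷-⊆ p))
    G-isotone {inside ∷ D} {outside ∷ D'} p = ⊥-elim (inside∷⊈outside∷ p)
    G-isotone {inside ∷ D} {inside ∷ D'} p = I₁.isotone (drop-∷-⊆ p)

    G-above : ∀ D → Lo D ≤* G D
    G-above (outside ∷ D) = I₀.above D
    G-above (inside ∷ D) a∈ = I₁.above D (there a∈)

    G-below : ∀ D → G D *≤ Up D
    G-below (outside ∷ D) b∈ = I₀.below D (∈-++⁺ˡ b∈)
    G-below (inside ∷ D) = I₁.below D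

-- Extension from a quasilattice

module _ {a b₁ b₂ p} (X : Poset a b₁ b₂) {P : Pred (Poset.Carrier X) p} where
  open Poset X

  Enumerates : ∀ {n} → (Fin n → Σ Carrier P) → Set (a ⊔ b₁ ⊔ p)
  Enumerates α = ∀ {x} → P x → ∃[ k ] x ≈ proj₁ (α k)

  module _ {c ℓ₁ ℓ₂} (Y : Poset c ℓ₁ ℓ₂) where

    isotoneOn-resp-≈ : ∀ {f} → IsotoneOn X Y P f →
                       ∀ {x y} (px : P x) (py : P y) → x ≈ y → Poset._≈_ Y (f (x , px)) (f (y , py))
    isotoneOn-resp-≈ f-isotone px py x≈y =
      Poset.antisym Y (f-isotone px py (reflexive x≈y)) (f-isotone py px (reflexive (Eq.sym x≈y)))

module _ (em : ∀ {ℓ} → ExcludedMiddle ℓ) {a b₁ b₂ c ℓ₁ ℓ₂}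
         (X : Poset a b₁ b₂) (Y : Poset c ℓ₁ ℓ₂) (q : IsQuasilattice Y) where
  private
    module X = Poset X
    module Y = Poset Y

  enumerated-extension : ∀ {p} {P : Pred X.Carrier p} {n} (α : Fin n → Σ X.Carrier P) →
                         Enumerates X α → ExtensionProperty X Y P
  enumerated-extension {P = P} {n} α enumerates f f-isotone = g , g-isotone , g-extends
    where
    point : Fin n → X.Carrier
    point = proj₁ ∘ α

    Below : X.Carrier → Fin n → Set b₂
    Below x k = point k X.≤ x

    AboveAll : Subset n → Fin n → Set b₂
    AboveAll D k = ∀ {d} → d ∈ₛ D → point d X.≤ point k

    down : X.Carrier → Subset n
    down x = subsetOf em (Below x)

    up : Subset n → Subset n
    up D = subsetOf em (AboveAll D)

    compatible : Compatible Y (valuesOn (f ∘ α)) (valuesOn (f ∘ α) ∘ up)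
    compatible {D' = D'} D⊆D' a∈ b∈ with ∈-valuesOn⁻ (f ∘ α) a∈ | ∈-valuesOn⁻ (f ∘ α) b∈
    ... | d , d∈D , refl | k , k∈up , refl =
      f-isotone (proj₂ (α d)) (proj₂ (α k)) (∈-subsetOf⁻ em (AboveAll D') k∈up (D⊆D' d∈D))

    open Interpolant (interpolant Y q compatible)

    g : X.Carrier → Y.Carrier
    g = value ∘ down

    g-isotone : Isotone X Y g
    g-isotone {x} {y} x≤y = isotone (λ k∈ → ∈-subsetOf⁺ em (Below y) (X.trans (∈-subsetOf⁻ em (Below x) k∈) x≤y))

    g-extends : Extends X Y P g f
    g-extends x px with enumerates px
    ... | k , x≈αk = Y.Eq.trans (Y.antisym g≤ ≤g) (isotoneOn-resp-≈ X Y f-isotone (proj₂ (α k)) px (X.Eq.sym x≈αk))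
      where
      g≤ : g x Y.≤ f (α k)
      g≤ = below (down x) (∈-valuesOn⁺ (f ∘ α) (∈-subsetOf⁺ em (AboveAll (down x))
             (λ d∈ → X.trans (∈-subsetOf⁻ em (Below x) d∈) (X.reflexive x≈αk))))
      ≤g : f (α k) Y.≤ g x
      ≤g = above (down x) (∈-valuesOn⁺ (f ∘ α) (∈-subsetOf⁺ em (Below x) (X.reflexive (X.Eq.sym x≈αk))))

  listSubset-extension : (A : List X.Carrier) → ExtensionProperty X Y (ListSubset X A)
  listSubset-extension A =
    enumerated-extension (λ k → lookup A k , SetoidMembership.∈-lookup X.Eq.setoid A k)
                         (λ x∈A → index x∈A , lookup-index x∈A)

  finite-extension : FinitePoset X → ∀ {p} (P : Pred X.Carrier p) → ExtensionProperty X Y P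
  finite-extension (N , e , e-onto) {p} P = enumerated-extension (lookup samples) enumerates
    where
    Represented : X.Carrier → Set (a ⊔ b₁ ⊔ p)
    Represented y = ∃[ x ] (P x × y X.≈ x)

    representative : ∀ {y} → Dec (Represented y) → Maybe (Σ X.Carrier P)
    representative y? = Maybe.map (λ (x , px , _) → x , px) (dec⇒maybe y?)

    samples : List (Σ X.Carrier P)
    samples = mapMaybe (λ i → representative (em {P = Represented (e i)})) (allFin N)

    represents : ∀ {x y} (y? : Dec (Represented y)) → P x → y X.≈ x →
                 MaybeAny.Any (λ z → x X.≈ proj₁ z) (representative y?)
    represents (yes (_ , _ , y≈x')) _ y≈x = MaybeAny.just (X.Eq.trans (X.Eq.sym y≈x) y≈x')
    represents (no ¬represented) px y≈x = ⊥-elim (¬represented (_ , px , y≈x))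

    sampled : ∀ {x} → P x → Any (λ z → x X.≈ proj₁ z) samples
    sampled {x} px with e-onto x
    ... | i , eᵢ≈x = mapMaybe⁺ _ (allFin N) (map⁺ (lose (∈-allFin i) (represents em px eᵢ≈x)))

    enumerates : Enumerates X (lookup samples)
    enumerates px = index (sampled px) , lookup-index (sampled px)

-- Bowties

data Bowtie (n m : ℕ) : Set where
  mid : Bowtie n m
  tip : Fin n ⊎ Fin m → Bowtie n m

pattern lo i = tip (inj₁ i)
pattern hi j = tip (inj₂ j)

module _ {n m : ℕ} where

  infix 4 _≼_

  data _≼_ : Bowtie n m → Bowtie n m → Set where
    ≼-refl : ∀ {x} → x ≼ x
    lo≼mid : ∀ {i} → lo i ≼ mid
    mid≼hi : ∀ {j} → mid ≼ hi j
    lo≼hi  : ∀ {i j} → lo i ≼ hi j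

  ≼-trans : ∀ {x y z} → x ≼ y → y ≼ z → x ≼ z
  ≼-trans ≼-refl y≼z = y≼z
  ≼-trans x≼y ≼-refl = x≼y
  ≼-trans lo≼mid mid≼hi = lo≼hi

  ≼-antisym : ∀ {x y} → x ≼ y → y ≼ x → x ≡ y
  ≼-antisym ≼-refl _ = refl

  tips : List (Fin n ⊎ Fin m)
  tips = tabulate (splitAt n)

  ∈-tips : ∀ t → t ∈ tips
  ∈-tips t = ≡.subst (_∈ tips) (splitAt-join n m t) (∈-tabulate⁺ (join n m t))

bowtie : ∀ n m (a b₁ b₂ : Level) → Poset a b₁ b₂
bowtie n m a b₁ b₂ = record
  { Carrier = Lift a (Bowtie n m)
  ; _≈_ = λ x y → Lift b₁ (lower x ≡ lower y)
  ; _≤_ = λ x y → Lift b₂ (lower x ≼ lower y)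
  ; isPartialOrder = record
    { isPreorder = record
      { isEquivalence = record
        { refl = lift refl
        ; sym = λ (lift x≡y) → lift (≡.sym x≡y)
        ; trans = λ (lift x≡y) (lift y≡z) → lift (≡.trans x≡y y≡z)
        }
      ; reflexive = λ { (lift refl) → lift ≼-refl }
      ; trans = λ (lift x≼y) (lift y≼z) → lift (≼-trans x≼y y≼z)
      }
    ; antisym = λ (lift x≼y) (lift y≼x) → lift (≼-antisym x≼y y≼x)
    }
  }

bowtie-finite : ∀ n m {a b₁ b₂} → FinitePoset (bowtie n m a b₁ b₂)
bowtie-finite n m = suc (n + m) , lift ∘ enumerate , λ x → onto (lower x)
  where
  enumerate : Fin (suc (n + m)) → Bowtie n m
  enumerate zero = mid
  enumerate (suc k) = tip (splitAt n k)

  onto : ∀ x → ∃[ k ] Lift _ (enumerate k ≡ x)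
  onto mid = zero , lift refl
  onto (tip t) = suc (join n m t) , lift (≡.cong tip (splitAt-join n m t))

record BowtieIn {a b₁ b₂ p} (X : Poset a b₁ b₂) (P : Pred (Poset.Carrier X) p) (n m : ℕ)
       : Set (a ⊔ b₁ ⊔ b₂ ⊔ p) where
  open Poset X
  field
    point          : Bowtie n m → Carrier
    point-isotone  : ∀ {x y} → x ≼ y → point x ≤ point y
    point-reflects : ∀ {t t'} → point (tip t) ≤ point (tip t') → tip t ≼ tip t'
    tip∈P          : ∀ t → P (point (tip t))
    P⊆tips         : ∀ {x} → P x → ∃[ t ] x ≈ point (tip t)

module _ {a b₁ b₂} {X : Poset a b₁ b₂} where
  open Poset X renaming (refl to ≤-refl; trans to ≤-trans)

  listed-tips : ∀ {n m} (point : Bowtie n m → Carrier) → (∀ {x y} → x ≼ y → point x ≤ point y) →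
                (∀ {t t'} → point (tip t) ≤ point (tip t') → tip t ≼ tip t') →
                BowtieIn X (ListSubset X (map (point ∘ tip) tips)) n m
  listed-tips point point-isotone point-reflects = record
    { point = point ; point-isotone = point-isotone ; point-reflects = point-reflects
    ; tip∈P = λ t → map⁺ (Any.map (λ { refl → Eq.refl }) (∈-tips t))
    ; P⊆tips = satisfied ∘ map⁻
    }

module _ {c ℓ₁ ℓ₂} (Y : Poset c ℓ₁ ℓ₂) {a b₁ b₂ p}
         (X : Poset a b₁ b₂) {P : Pred (Poset.Carrier X) p} where
  private
    module X = Poset X
  open Poset Y renaming (refl to ≤-refl; trans to ≤-trans)
  open Bounds Y

  bowtie-interpolant : ExtensionProperty X Y P → (A B : List Carrier) → (∀ {a b} → a ∈ A → b ∈ B → a ≤ b) →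
                       BowtieIn X P (length A) (length B) → ∃[ y ] (A ≤* y × y *≤ B)
  bowtie-interpolant extend A B A≤B bowtie = g (point mid) , A≤g-mid , g-mid≤B
    where
    open BowtieIn bowtie

    label : Fin (length A) ⊎ Fin (length B) → Carrier
    label = [ lookup A , lookup B ]′

    label-isotone : ∀ {t t'} → tip t ≼ tip t' → label t ≤ label t'
    label-isotone ≼-refl = ≤-refl
    label-isotone (lo≼hi {i} {j}) = A≤B (∈-lookup i) (∈-lookup j)

    label-reflects : ∀ {t t'} → point (tip t) X.≤ point (tip t') → label t ≤ label t'
    label-reflects = label-isotone ∘ point-reflects

    f : Σ X.Carrier P → Carrier
    f (_ , px) = label (proj₁ (P⊆tips px))

    f-isotone : IsotoneOn X Y P f
    f-isotone px py x≤y = label-reflects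
      (X.trans (X.reflexive (X.Eq.sym (proj₂ (P⊆tips px)))) (X.trans x≤y (X.reflexive (proj₂ (P⊆tips py)))))

    extension : ∃[ g ] (Isotone X Y g × Extends X Y P g f)
    extension = extend f f-isotone

    g : X.Carrier → Carrier
    g = proj₁ extension

    g-isotone : Isotone X Y g
    g-isotone = proj₁ (proj₂ extension)

    g-at-tip : ∀ t → g (point (tip t)) ≈ label t
    g-at-tip t = Eq.trans (proj₂ (proj₂ extension) _ (tip∈P t))
      (antisym (label-reflects (X.reflexive (X.Eq.sym t≈t'))) (label-reflects (X.reflexive t≈t')))
      where
      t≈t' : point (tip t) X.≈ point (tip (proj₁ (P⊆tips (tip∈P t))))
      t≈t' = proj₂ (P⊆tips (tip∈P t))

    A≤g-mid : A ≤* g (point mid)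
    A≤g-mid a∈A = ≡.subst (_≤ g (point mid)) (≡.sym (lookup-index a∈A))
      (≤-trans (reflexive (Eq.sym (g-at-tip (inj₁ (index a∈A))))) (g-isotone (point-isotone lo≼mid)))

    g-mid≤B : g (point mid) *≤ B
    g-mid≤B b∈B = ≡.subst (g (point mid) ≤_) (≡.sym (lookup-index b∈B))
      (≤-trans (g-isotone (point-isotone mid≼hi)) (reflexive (g-at-tip (inj₂ (index b∈B)))))

IsTip : ∀ {n m} → Bowtie n m → Set
IsTip mid = ⊥
IsTip (tip _) = ⊤

tips-of-bowtie : ∀ {n m a b₁ b₂} p → BowtieIn (bowtie n m a b₁ b₂) (λ x → Lift p (IsTip (lower x))) n m
tips-of-bowtie p = record
  { point = lift ; point-isotone = lift ; point-reflects = lower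
  ; tip∈P = λ _ → lift tt
  ; P⊆tips = λ { {lift (tip t)} _ → t , lift refl }
  }

module _ (n m : ℕ) where

  fcPoint : Bowtie n m → List ℕ
  fcPoint mid = upTo n
  fcPoint (lo i) = toℕ i ∷ []
  fcPoint (hi j) = n + toℕ j ∷ upTo n

  private module FC = Poset FC

  fcPoint-lo⊆mid : ∀ i → fcPoint (lo i) FC.≤ fcPoint mid
  fcPoint-lo⊆mid i (here refl) = ∈-upTo⁺ (toℕ<n i)

  fcPoint-isotone : ∀ {x y} → x ≼ y → fcPoint x FC.≤ fcPoint y
  fcPoint-isotone ≼-refl = FC.refl
  fcPoint-isotone (lo≼mid {i}) = fcPoint-lo⊆mid i
  fcPoint-isotone mid≼hi = there
  fcPoint-isotone (lo≼hi {i}) = there ∘ fcPoint-lo⊆mid i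

  n+k∉upTo : ∀ k → n + k ∈ upTo n → ⊥
  n+k∉upTo k = m+n≮m n k ∘ ∈-upTo⁻

  fcPoint-reflects : ∀ {t t'} → fcPoint (tip t) FC.≤ fcPoint (tip t') → tip t ≼ tip t'
  fcPoint-reflects {inj₁ i} {inj₁ i'} ⊆ with ⊆ (here refl)
  ... | here i≡i' rewrite toℕ-injective i≡i' = ≼-refl
  fcPoint-reflects {inj₁ _} {inj₂ _} _ = lo≼hi
  fcPoint-reflects {inj₂ j} {inj₁ i} ⊆ = ⊥-elim (n+k∉upTo (toℕ j) (fcPoint-lo⊆mid i (⊆ (here refl))))
  fcPoint-reflects {inj₂ j} {inj₂ j'} ⊆ with ⊆ (here refl)
  ... | here n+j≡n+j' rewrite toℕ-injective (+-cancelˡ-≡ n (toℕ j) (toℕ j') n+j≡n+j') = ≼-refl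
  ... | there n+j∈ = ⊥-elim (n+k∉upTo (toℕ j) n+j∈)

module _ {c ℓ₁ ℓ₂} (Y : Poset c ℓ₁ ℓ₂) where

  quasilattice-from-finite-extensions : ∀ {a b₁ b₂ p} →
    ((X : Poset a b₁ b₂) → FinitePoset X → (A : Pred (Poset.Carrier X) p) → ExtensionProperty X Y A) →
    IsQuasilattice Y
  quasilattice-from-finite-extensions {a} {b₁} {b₂} {p} extend A B A≤B =
    bowtie-interpolant Y X (extend X (bowtie-finite _ _ {a} {b₁} {b₂}) _) A B A≤B (tips-of-bowtie p)
    where
    X : Poset a b₁ b₂
    X = bowtie (length A) (length B) a b₁ b₂

  quasilattice-from-listSubset-extensions : ∀ {a b₁ b₂} →
    ((X : Poset a b₁ b₂) → (A : List (Poset.Carrier X)) → ExtensionProperty X Y (ListSubset X A)) →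
    IsQuasilattice Y
  quasilattice-from-listSubset-extensions {a} {b₁} {b₂} extend A B A≤B =
    bowtie-interpolant Y X (extend X _) A B A≤B (listed-tips lift lift lower)
    where
    X : Poset a b₁ b₂
    X = bowtie (length A) (length B) a b₁ b₂

  quasilattice-from-FC-extensions :
    ((A : List (Poset.Carrier FC)) → ExtensionProperty FC Y (ListSubset FC A)) → IsQuasilattice Y
  quasilattice-from-FC-extensions extend A B A≤B =
    bowtie-interpolant Y FC (extend _) A B A≤B
      (listed-tips (fcPoint n m) (fcPoint-isotone n m) (fcPoint-reflects n m))
    where
    n m : ℕ
    n = length A
    m = length B

theorem4p11 : (em : ∀ {ℓ} → ExcludedMiddle ℓ) →
    {c ℓ₁ ℓ₂ a b₁ b₂ p : Level} (Y : Poset c ℓ₁ ℓ₂) → Poset.Carrier Y →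
      (IsQuasilattice Y ⇔
        ((X : Poset a b₁ b₂) → FinitePoset X → (A : Pred (Poset.Carrier X) p) → ExtensionProperty X Y A))
    × (IsQuasilattice Y ⇔
        ((X : Poset a b₁ b₂) → (A : List (Poset.Carrier X)) → ExtensionProperty X Y (ListSubset X A)))
    × (IsQuasilattice Y ⇔
        ((A : List (Poset.Carrier FC)) → ExtensionProperty FC Y (ListSubset FC A)))
theorem4p11 em Y _ =
  mk⇔ (λ q X finite → finite-extension em X Y q finite) (quasilattice-from-finite-extensions Y) ,
  mk⇔ (λ q X → listSubset-extension em X Y q) (quasilattice-from-listSubset-extensions Y) ,
  mk⇔ (listSubset-extension em FC Y) (quasilattice-from-FC-extensions Y)
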